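{- Let $q,q',n$ be integers with $q'\ge 2q>3$ and $n>1$. Let $S$ be an $\mathcal{OS}_q(n)$ with ring sequence $[s_0,\ldots,s_{m-1}]$ and let $s'_i\in\mathbb{Z}_{q'}$ be as defined below. Let $T$ be the sequence over $\mathbb{Z}_{q'}$ with ring sequence $[t_0,\ldots,t_{m-1}]$, where $t_i=(-1)^{i+m-1}s'_i$ if $s'_i\neq 0$, and $t_i=(-1)^{i+m-1}q$ (computed in $\mathbb{Z}_{q'}$) if $s'_i=0$, for $i=0,\ldots,m-1$. Then $T$ is an $\mathcal{SOS}_{q'}(n)$.
   Context: For $x\in\mathbb{Z}_q$, $x'$ denotes the residue class in $\mathbb{Z}_{q'}$ of the unique integer in $\{0,\ldots,q-1\}$ representing $x$. A periodic sequence of period $m$ is described by its ring sequence (one period). Write $\mathbf{s}_n(i)=(s_i,\ldots,s_{i+n-1})$; for an $n$-tuple $\mathbf{u}$, $\mathbf{u}^R$ is its reverse and $-\mathbf{u}$ its entrywise negative. An $n$-window sequence of period $m$ is one where $\mathbf{s}_n(i)=\mathbf{s}_n(j)$ implies $i\equiv j\pmod m$. An $\mathcal{OS}_q(n)$ is an $n$-window sequence over $\mathbb{Z}_q$ with $\mathbf{s}_n(i)\neq\mathbf{s}_n(j)^R$ for all $i,j$; an $\mathcal{SOS}_q(n)$ is an $\mathcal{OS}_q(n)$ with additionally $\mathbf{s}_n(i)\neq-\mathbf{s}_n(j)^R$ for all $i,j$. -}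

module Defs where

open import Data.Nat using (ℕ; zero; suc; _+_; _*_; _∸_; _≡ᵇ_; NonZero)
open import Data.Nat.DivMod using (_%_; _mod_)
open import Data.Fin using (Fin; toℕ)
open import Data.Vec using (Vec; tabulate; reverse; map)
open import Data.Bool using (if_then_else_)
open import Data.Product using (_×_)
open import Relation.Binary.PropositionalEquality using (_≡_; _≢_)

-- Z_q is represented by Fin q (residues 0..q-1).

negZ : (q : ℕ) .{{_ : NonZero q}} → Fin q → Fin q
negZ q x = (q ∸ toℕ x) mod q

-- x' : the class in Z_{q'} of the representative of x in {0..q-1}
lift : {q : ℕ} (q' : ℕ) .{{_ : NonZero q'}} → Fin q → Fin q'
lift q' x = toℕ x mod q'

-- a periodic sequence of period m is given by its ring sequence  Fin m → A
-- s_i for arbitrary i : ℕ (indices taken mod m)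
at : {A : Set} {m : ℕ} .{{_ : NonZero m}} → (Fin m → A) → ℕ → A
at {m = m} s i = s (i mod m)

window : {A : Set} {m : ℕ} .{{_ : NonZero m}} → (Fin m → A) → (n : ℕ) → ℕ → Vec A n
window s n i = tabulate (λ k → at s (i + toℕ k))

IsWindowSeq : {A : Set} {m : ℕ} .{{_ : NonZero m}} → ℕ → (Fin m → A) → Set
IsWindowSeq {m = m} n s = ∀ i j → window s n i ≡ window s n j → i % m ≡ j % m

IsOS : (q : ℕ) {m : ℕ} .{{_ : NonZero m}} → ℕ → (Fin m → Fin q) → Set
IsOS q n s = IsWindowSeq n s × (∀ i j → window s n i ≢ reverse (window s n j))

IsSOS : (q : ℕ) .{{_ : NonZero q}} {m : ℕ} .{{_ : NonZero m}} → ℕ → (Fin m → Fin q) → Set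
IsSOS q n s = IsOS q n s × (∀ i j → window s n i ≢ reverse (map (negZ q) (window s n j)))

construct : {q : ℕ} (q' : ℕ) .{{_ : NonZero q'}} {m : ℕ} → (Fin m → Fin q) → Fin m → Fin q'
construct {q} q' {m} s i =
  let s'  = lift q' (s i)
      v   = if toℕ s' ≡ᵇ 0 then q mod q' else s'
  in if ((toℕ i + m ∸ 1) % 2) ≡ᵇ 0 then v else negZ q' v

{-# OPTIONS --safe #-}
-- Decode y ∈ ℤ_q' as min(y, q' − y) mod q.  This is invariant under negation, and it
-- sends t_i to s_i because the magnitude of t_i lies in {1, …, q} ⊆ {0, …, q' − q}.
-- Hence the windows of T and of −T decode to the windows of S, and any coincidence of
-- windows that T must avoid decodes to one that S avoids.
module Submission where

open import Defs
open import Data.Nat using (ℕ; _*_; _<_; _≤_; NonZero; _+_; _∸_; _⊓_; _%_; _≡ᵇ_; z<s; >-nonZero⁻¹)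
open import Data.Nat.Properties
open import Data.Nat.DivMod using (_mod_; m%n<n; m<n⇒m%n≡m; n%n≡0)
open import Data.Fin using (Fin; zero; suc; toℕ)
open import Data.Fin.Properties using (toℕ-fromℕ<; toℕ-injective; toℕ<n)
open import Data.Vec using (map; reverse)
open import Data.Vec.Properties using (map-reverse; tabulate-∘; tabulate-cong)
open import Data.Bool using (Bool; true; false; if_then_else_)
open import Data.Product using (_,_)
open import Function using (_∘_)
open import Relation.Binary.PropositionalEquality

module _ {A B : Set} {m : ℕ} .{{_ : NonZero m}} (f : A → B) {s : Fin m → B} where

  map-window : {t : Fin m → A} → f ∘ t ≗ s → ∀ n i → map f (window t n i) ≡ window s n i
  map-window f∘t≗s n i = trans (sym (tabulate-∘ f _)) (tabulate-cong (λ _ → f∘t≗s _))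

  IsWindowSeq-reflect : ∀ {n} {t : Fin m → A} → f ∘ t ≗ s → IsWindowSeq n s → IsWindowSeq n t
  IsWindowSeq-reflect {n} {t} f∘t≗s s-win i j eq = s-win i j (begin
    window s n i         ≡⟨ map-window f∘t≗s n i ⟨
    map f (window t n i) ≡⟨ cong (map f) eq ⟩
    map f (window t n j) ≡⟨ map-window f∘t≗s n j ⟩
    window s n j         ∎)
    where open ≡-Reasoning

  window≢reverse-reflect : ∀ {n} {t u : Fin m → A} → f ∘ t ≗ s → f ∘ u ≗ s →
    (∀ i j → window s n i ≢ reverse (window s n j)) →
    ∀ i j → window t n i ≢ reverse (window u n j)
  window≢reverse-reflect {n} {t} {u} f∘t≗s f∘u≗s s-norev i j eq = s-norev i j (begin
    window s n i                   ≡⟨ map-window f∘t≗s n i ⟨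
    map f (window t n i)           ≡⟨ cong (map f) eq ⟩
    map f (reverse (window u n j)) ≡⟨ map-reverse f (window u n j) ⟩
    reverse (map f (window u n j)) ≡⟨ cong reverse (map-window f∘u≗s n j) ⟩
    reverse (window s n j)         ∎)
    where open ≡-Reasoning

IsSOS-from-decoding : ∀ {q q' m n} .{{_ : NonZero q'}} .{{_ : NonZero m}}
  {s : Fin m → Fin q} {t : Fin m → Fin q'} (decode : Fin q' → Fin q) →
  (∀ y → decode (negZ q' y) ≡ decode y) → decode ∘ t ≗ s →
  IsOS q n s → IsSOS q' n t
IsSOS-from-decoding {q' = q'} {n = n} {s} {t} decode decode-negZ decode∘t≗s (s-win , s-norev) =
  (IsWindowSeq-reflect decode decode∘t≗s s-win , window≢reverse-reflect decode decode∘t≗s decode∘t≗s s-norev) ,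
  λ i j → subst (λ w → window t n i ≢ reverse w) (sym (map-window (negZ q') {t = t} (λ _ → refl) n j))
            (window≢reverse-reflect decode decode∘t≗s decode∘-t≗s s-norev i j)
  where
  decode∘-t≗s : decode ∘ negZ q' ∘ t ≗ s
  decode∘-t≗s i = trans (decode-negZ (t i)) (decode∘t≗s i)

toℕ-mod : ∀ a n .{{_ : NonZero n}} → toℕ (a mod n) ≡ a % n
toℕ-mod a n = toℕ-fromℕ< (m%n<n a n)

toℕ-mod-< : ∀ {a n} .{{_ : NonZero n}} → a < n → toℕ (a mod n) ≡ a
toℕ-mod-< {a} {n} a<n = trans (toℕ-mod a n) (m<n⇒m%n≡m a<n)

toℕ-mod-toℕ : ∀ {n} .{{_ : NonZero n}} (x : Fin n) → toℕ x mod n ≡ x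
toℕ-mod-toℕ x = toℕ-injective (toℕ-mod-< (toℕ<n x))

toℕ-lift : ∀ {q q'} .{{_ : NonZero q'}} → q ≤ q' → (x : Fin q) → toℕ (lift q' x) ≡ toℕ x
toℕ-lift q≤q' x = toℕ-mod-< (<-≤-trans (toℕ<n x) q≤q')

absZ : (q : ℕ) → Fin q → ℕ
absZ q y = toℕ y ⊓ (q ∸ toℕ y)

absZ-negZ : ∀ q .{{_ : NonZero q}} (y : Fin q) → absZ q (negZ q y) ≡ absZ q y
absZ-negZ q zero = cong (λ w → w ⊓ (q ∸ w)) (trans (toℕ-mod q q) (n%n≡0 q))
absZ-negZ q y@(suc _) = begin
  absZ q (negZ q y)                ≡⟨ cong (λ w → w ⊓ (q ∸ w)) (toℕ-mod-< (∸-monoʳ-< z<s y≤q)) ⟩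
  (q ∸ toℕ y) ⊓ (q ∸ (q ∸ toℕ y)) ≡⟨ cong ((q ∸ toℕ y) ⊓_) (m∸[m∸n]≡n y≤q) ⟩
  (q ∸ toℕ y) ⊓ toℕ y             ≡⟨ ⊓-comm (q ∸ toℕ y) (toℕ y) ⟩
  absZ q y                         ∎
  where
  open ≡-Reasoning
  y≤q : toℕ y ≤ q
  y≤q = <⇒≤ (toℕ<n y)

decode : (q : ℕ) .{{_ : NonZero q}} (q' : ℕ) → Fin q' → Fin q
decode q q' y = absZ q' y mod q

decode-negZ : ∀ {q q'} .{{_ : NonZero q}} .{{_ : NonZero q'}} (y : Fin q') →
  decode q q' (negZ q' y) ≡ decode q q' y
decode-negZ {q} {q'} y = cong (_mod q) (absZ-negZ q' y)

decode-if-negZ : ∀ {q q'} .{{_ : NonZero q}} .{{_ : NonZero q'}} (b : Bool) (y : Fin q') →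
  decode q q' (if b then y else negZ q' y) ≡ decode q q' y
decode-if-negZ true  y = refl
decode-if-negZ false y = decode-negZ y

zero↦q : (q : ℕ) {q' : ℕ} .{{_ : NonZero q'}} → Fin q' → Fin q'
zero↦q q {q'} y = if toℕ y ≡ᵇ 0 then q mod q' else y

module _ {q q' : ℕ} .{{_ : NonZero q}} .{{_ : NonZero q'}} (2q≤q' : 2 * q ≤ q') where

  private
    q+q≤q' : q + q ≤ q'
    q+q≤q' = subst (λ k → q + k ≤ q') (+-identityʳ q) 2q≤q'

    q<q' : q < q'
    q<q' = <-≤-trans (m<m+n q (>-nonZero⁻¹ q)) q+q≤q'

  decode-≤ : (y : Fin q') → toℕ y ≤ q → decode q q' y ≡ toℕ y mod q
  decode-≤ y y≤q = cong (_mod q) (m≤n⇒m⊓n≡m (begin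
    toℕ y      ≤⟨ y≤q ⟩
    q          ≤⟨ m+n≤o⇒m≤o∸n q q+q≤q' ⟩
    q' ∸ q     ≤⟨ ∸-monoʳ-≤ q' y≤q ⟩
    q' ∸ toℕ y ∎))
    where open ≤-Reasoning

  decode-zero↦q : (x : Fin q) (y : Fin q') → toℕ y ≡ toℕ x → decode q q' (zero↦q q y) ≡ x
  decode-zero↦q zero zero _ = begin
    decode q q' (q mod q') ≡⟨ decode-≤ (q mod q') (≤-reflexive toℕ-q) ⟩
    toℕ (q mod q') mod q   ≡⟨ cong (_mod q) toℕ-q ⟩
    q mod q                ≡⟨ toℕ-injective (trans (toℕ-mod q q) (n%n≡0 q)) ⟩
    zero                   ∎
    where
    open ≡-Reasoning
    toℕ-q : toℕ (q mod q') ≡ q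
    toℕ-q = toℕ-mod-< q<q'
  decode-zero↦q x@(suc _) y@(suc _) y≡x = begin
    decode q q' y ≡⟨ decode-≤ y (subst (_≤ q) (sym y≡x) (<⇒≤ (toℕ<n x))) ⟩
    toℕ y mod q   ≡⟨ cong (_mod q) y≡x ⟩
    toℕ x mod q   ≡⟨ toℕ-mod-toℕ x ⟩
    x             ∎
    where open ≡-Reasoning
  decode-zero↦q zero    (suc _) ()
  decode-zero↦q (suc _) zero    ()

  decode-construct : ∀ {m} (s : Fin m → Fin q) → decode q q' ∘ construct q' s ≗ s
  decode-construct {m} s i = trans
    (decode-if-negZ ((toℕ i + m ∸ 1) % 2 ≡ᵇ 0) (zero↦q q (lift q' (s i))))
    (decode-zero↦q (s i) (lift q' (s i)) (toℕ-lift (<⇒≤ q<q') (s i)))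

lemma3p12 : (q q' n m : ℕ) .{{_ : NonZero q}} .{{_ : NonZero q'}} .{{_ : NonZero m}} →
    2 * q ≤ q' → 3 < 2 * q → 1 < n →
    (s : Fin m → Fin q) → IsOS q n s →
    IsSOS q' n (construct q' s)
lemma3p12 q q' n m 2q≤q' _ _ s =
  IsSOS-from-decoding (decode q q') decode-negZ (decode-construct 2q≤q' s)
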